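{- Let $D$ be a dendriform algebra over a field $k$ of characteristic zero, $a\in D$, and let $\Omega'=\Omega'(\lambda a)\in\lambda D[[\lambda]]$ be the unique element satisfying $$\Omega'=\sum_{m\ge0}\frac{B_m}{m!}\,L_\rhd[\Omega']^{m}(\lambda a),$$ where $L_\rhd[x](y):=x\rhd y$. Then $$\Omega'(\lambda a)=\sum_{t\in\mathcal T^{e1}_{pl}}\alpha(t)\,\lambda^{\deg t}\,F[t](a).$$
   Context: A dendriform algebra over $k$ is a $k$-vector space $D$ with bilinear operations $\prec,\succ$ such that $(a\prec b)\prec c=a\prec(b\prec c+b\succ c)$, $(a\succ b)\prec c=a\succ(b\prec c)$, $a\succ(b\succ c)=(a\prec b+a\succ b)\succ c$; the left pre-Lie product is $a\rhd b:=a\succ b-b\prec a$, extended $\lambda$-bilinearly. $B_m$ are the Bernoulli numbers with $B_0=1$, $B_1=-1/2$, $B_2=1/6$, $B_{2n+1}=0$ for $n\ge1$. Planar rooted trees: $\bullet$ is the one-vertex tree, and every other planar rooted tree is uniquely $t=B_+(t_1,\dots,t_n)$, $n\ge1$, the tree obtained by attaching the roots of the ordered list $t_1,\dots,t_n$ to a new root; $\deg t$ is the number of vertices and $f(v)$ the number of children (fertility) of a vertex $v$. $\mathcal T^{e1}_{pl}$ is the set of planar rooted trees having no vertex $v$ with $f(v)=2n+1$ for some $n>0$. Define $\alpha(t):=\prod_{v\in V(t)}B_{f(v)}/f(v)!$ (equivalently $\alpha(\bullet)=1$, $\alpha(B_+(t_1,\dots,t_n))=\frac{B_n}{n!}\prod_i\alpha(t_i)$).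 Define $F[\bullet](a)=a$ and $F[B_+(t_1,\dots,t_n)](a):=F[t_1](a)\rhd\bigl(F[t_2](a)\rhd\cdots\rhd(F[t_n](a)\rhd a)\cdots\bigr)$. The sum converges $\lambda$-adically since there are finitely many trees of each degree. -}

module Defs where

open import Level using (Level; _⊔_) renaming (suc to lsuc)
open import Data.Nat as ℕ using (ℕ; zero; suc; _∸_; _!; _≤ᵇ_)
open import Data.Nat.Properties using (_!≢0)
open import Data.Nat.Combinatorics using (_C_)
open import Data.Integer as ℤ using (ℤ; +_; -[1+_])
open import Data.Rational as ℚ using (ℚ; _/_; 0ℚ; 1ℚ; ↥_; ↧ₙ_)
open import Data.Bool using (Bool; true; false; not; _∧_; if_then_else_)
open import Data.List as List using (List; []; _∷_; map; concatMap; foldr; length; upTo; reverse; zipWith; filter)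
open import Data.Empty using (⊥)
open import Relation.Nullary using (¬_)
open import Relation.Nullary.Decidable using (T?)
open import Relation.Binary.PropositionalEquality using (_≡_)
open import Algebra.Bundles using (CommutativeRing)
open import Algebra.Module.Bundles using (Module)

record Field (c ℓ : Level) : Set (lsuc (c ⊔ ℓ)) where
  field
    commutativeRing : CommutativeRing c ℓ
  open CommutativeRing commutativeRing public
  field
    0≉1      : ¬ (0# ≈ 1#)
    inv      : (x : Carrier) → ¬ (x ≈ 0#) → Carrier
    inverseʳ : (x : Carrier) (p : ¬ (x ≈ 0#)) → x * inv x p ≈ 1#

module _ {c ℓ : Level} (K : Field c ℓ) where
  open Field K

  natK : ℕ → Carrier
  natK zero    = 0#
  natK (suc n) = 1# + natK n

  intK : ℤ → Carrier
  intK (+ n)     = natK n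
  intK -[1+ n ]  = - natK (suc n)

  CharZero : Set ℓ
  CharZero = (n : ℕ) → natK (suc n) ≈ 0# → ⊥

  embedℚ : CharZero → ℚ → Carrier
  embedℚ cz q = intK (↥ q) * inv (natK (↧ₙ q)) (cz (ℚ.denominator-1 q))

record Dendriform {c ℓ m ℓm : Level} (K : Field c ℓ)
                  (V : Module (Field.commutativeRing K) m ℓm)
                  : Set (c ⊔ ℓ ⊔ m ⊔ ℓm) where
  open Field K using (Carrier)
  open Module V using (Carrierᴹ; _≈ᴹ_; _+ᴹ_; _*ₗ_)
  infixl 7 _≺_ _≻_
  field
    _≺_ : Carrierᴹ → Carrierᴹ → Carrierᴹ
    _≻_ : Carrierᴹ → Carrierᴹ → Carrierᴹ
    ≺-cong  : ∀ {x x' y y'} → x ≈ᴹ x' → y ≈ᴹ y' → (x ≺ y) ≈ᴹ (x' ≺ y')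
    ≻-cong  : ∀ {x x' y y'} → x ≈ᴹ x' → y ≈ᴹ y' → (x ≻ y) ≈ᴹ (x' ≻ y')
    ≺-distribˡ : ∀ x y z → (x ≺ (y +ᴹ z)) ≈ᴹ ((x ≺ y) +ᴹ (x ≺ z))
    ≺-distribʳ : ∀ x y z → ((y +ᴹ z) ≺ x) ≈ᴹ ((y ≺ x) +ᴹ (z ≺ x))
    ≻-distribˡ : ∀ x y z → (x ≻ (y +ᴹ z)) ≈ᴹ ((x ≻ y) +ᴹ (x ≻ z))
    ≻-distribʳ : ∀ x y z → ((y +ᴹ z) ≻ x) ≈ᴹ ((y ≻ x) +ᴹ (z ≻ x))
    ≺-scalarˡ : ∀ (r : Carrier) x y → ((r *ₗ x) ≺ y) ≈ᴹ (r *ₗ (x ≺ y))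
    ≺-scalarʳ : ∀ (r : Carrier) x y → (x ≺ (r *ₗ y)) ≈ᴹ (r *ₗ (x ≺ y))
    ≻-scalarˡ : ∀ (r : Carrier) x y → ((r *ₗ x) ≻ y) ≈ᴹ (r *ₗ (x ≻ y))
    ≻-scalarʳ : ∀ (r : Carrier) x y → (x ≻ (r *ₗ y)) ≈ᴹ (r *ₗ (x ≻ y))
    dend₁ : ∀ a b c → ((a ≺ b) ≺ c) ≈ᴹ (a ≺ ((b ≺ c) +ᴹ (b ≻ c)))
    dend₂ : ∀ a b c → ((a ≻ b) ≺ c) ≈ᴹ (a ≻ (b ≺ c))
    dend₃ : ∀ a b c → (a ≻ (b ≻ c)) ≈ᴹ (((a ≺ b) +ᴹ (a ≻ b)) ≻ c)

-- Bernoulli numbers (B₁ = -1/2) via  Σ_{j=0}^{n} C(n+1,j) B_j = 0  (n ≥ 1)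

sumℚ : List ℚ → ℚ
sumℚ = foldr ℚ._+_ 0ℚ

natℚ : ℕ → ℚ
natℚ n = (+ n) / 1

-- bernRev n = [B_n, B_{n-1}, …, B_0]
bernRev : ℕ → List ℚ
bernRev zero    = 1ℚ ∷ []
bernRev (suc n) = next ∷ prev
  where
  prev : List ℚ
  prev = bernRev n
  next : ℚ
  next = ℚ.- (((+ 1) / suc (suc n)) ℚ.*
           sumℚ (zipWith (λ j b → natℚ (suc (suc n) C j) ℚ.* b)
                         (upTo (suc n)) (reverse prev)))

bernoulli : ℕ → ℚ
bernoulli n with bernRev n
... | []    = 0ℚ
... | b ∷ _ = b

bernFact : ℕ → ℚ
bernFact m = bernoulli m ℚ.* ((+ 1) / (m !)) {{m !≢0}}

-- Planar rooted trees: node [] = •,  node (t₁ ∷ … ∷ tₙ ∷ []) = B₊(t₁,…,tₙ)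

data PTree : Set where
  node : List PTree → PTree

-- all forests (ordered lists of planar trees) of total degree n, with
-- fuel f (complete as soon as f ≥ n); first tree has degree i+1.
forestsF : ℕ → ℕ → List (List PTree)
forestsF f       zero    = [] ∷ []
forestsF zero    (suc n) = []
forestsF (suc f) (suc n) =
  concatMap (λ i → concatMap (λ g → map (node g ∷_) (forestsF f (n ∸ i)))
                             (forestsF f i))
            (upTo (suc n))

treesOfDeg : ℕ → List PTree
treesOfDeg zero    = []
treesOfDeg (suc n) = map node (forestsF n n)

oddB : ℕ → Bool
oddB zero    = false
oddB (suc n) = not (oddB n)

badFert : ℕ → Bool
badFert n = oddB n ∧ (3 ≤ᵇ n)

mutual
  inTe1 : PTree → Bool
  inTe1 (node ts) = not (badFert (length ts)) ∧ allTe1 ts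

  allTe1 : List PTree → Bool
  allTe1 []       = true
  allTe1 (t ∷ ts) = inTe1 t ∧ allTe1 ts

mutual
  α : PTree → ℚ
  α (node ts) = bernFact (length ts) ℚ.* αs ts

  αs : List PTree → ℚ
  αs []       = 1ℚ
  αs (t ∷ ts) = α t ℚ.* αs ts

module _ {c ℓ m ℓm : Level} (K : Field c ℓ) (cz : CharZero K)
         (V : Module (Field.commutativeRing K) m ℓm)
         (Dd : Dendriform K V) where
  open Module V using (Carrierᴹ; _≈ᴹ_; _+ᴹ_; _*ₗ_; 0ᴹ; -ᴹ_)
  open Dendriform Dd

  _▹_ : Carrierᴹ → Carrierᴹ → Carrierᴹ
  a ▹ b = (a ≻ b) +ᴹ (-ᴹ (b ≺ a))

  sumᴹ : List Carrierᴹ → Carrierᴹ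
  sumᴹ = foldr _+ᴹ_ 0ᴹ

  -- formal power series in λ: the n-th coefficient
  Series : Set m
  Series = ℕ → Carrierᴹ

  _▹ₛ_ : Series → Series → Series
  (x ▹ₛ y) n = sumᴹ (map (λ i → x i ▹ y (n ∸ i)) (upTo (suc n)))

  λ· : Carrierᴹ → Series
  λ· a (suc zero) = a
  λ· a _          = 0ᴹ

  Lpow : Series → ℕ → Series → Series
  Lpow x zero    y = y
  Lpow x (suc k) y = x ▹ₛ Lpow x k y

  -- Σ_{m ≥ 0} (B_m/m!) L_▹[Ω]^m (λa), n-th coefficient.  For Ω ∈ λD[[λ]]
  -- the m-th term has λ-order ≥ m+1, so only m ≤ n contribute.
  magnusRHS : Series → Carrierᴹ → Series
  magnusRHS Ω a n =
    sumᴹ (map (λ k → embedℚ K cz (bernFact k) *ₗ Lpow Ω k (λ· a) n)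
              (upTo (suc n)))

  mutual
    F : PTree → Carrierᴹ → Carrierᴹ
    F (node ts) a = Fs ts a

    Fs : List PTree → Carrierᴹ → Carrierᴹ
    Fs []       a = a
    Fs (t ∷ ts) a = F t a ▹ Fs ts a

  treeSeries : Carrierᴹ → Series
  treeSeries a n =
    sumᴹ (map (λ t → embedℚ K cz (α t) *ₗ F t a)
              (filter (λ t → T? (inTe1 t)) (treesOfDeg n)))

module Submission where

open import Defs
open import Level using (Level)
open import Data.Nat using (ℕ; zero; suc)
open import Algebra.Bundles using (CommutativeMonoid)
open import Algebra.Module.Bundles using (Module)

-- Let T_d be the sum of α(t) F[t](a) over ALL planar trees of degree d. By strong induction,
-- Ω_d = T_d: if Ω agrees with T below degree n + 1, the coefficient of λⁿ⁺¹ in L_▷[Ω]ᵏ(λa) is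
-- the sum over forests (t₁,…,t_k) of total degree n of α(t₁)⋯α(t_k) F[t₁](a) ▷ (⋯ ▷ (F[t_k](a) ▷ a)),
-- and weighting by B_k/k! and summing over k regroups exactly the trees B₊(t₁,…,t_k) of degree n + 1.
-- Restricting to T^{e1}_pl changes nothing because B_{2m+1} = 0 for m ≥ 1, i.e. x/(eˣ − 1) + x/2
-- is even, which is checked in the ring of exponential generating functions over ℚ.

module FiniteSums {c ℓ : Level} (M : CommutativeMonoid c ℓ) where

  open import Data.Nat using (_<_; z≤n; s≤s)
  open import Data.List using (List; []; _∷_; foldr; map; _++_; concatMap; upTo; applyUpTo)
  open import Data.List.Properties using (map-upTo; map-++)
  open import Data.List.Relation.Unary.All using (All; []; _∷_)
  open import Relation.Binary.PropositionalEquality as ≡ using (_≡_)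
  open import Relation.Nullary using (¬_)
  open CommutativeMonoid M
  open import Algebra.Properties.CommutativeSemigroup commutativeSemigroup using (interchange)
  open import Relation.Binary.Reasoning.Setoid setoid

  sumˡ : List Carrier → Carrier
  sumˡ = foldr _∙_ ε

  sumBelow : (ℕ → Carrier) → ℕ → Carrier
  sumBelow h zero    = ε
  sumBelow h (suc n) = h 0 ∙ sumBelow (λ i → h (suc i)) n

  sumˡ-applyUpTo : ∀ h n → sumˡ (applyUpTo h n) ≡ sumBelow h n
  sumˡ-applyUpTo h zero    = ≡.refl
  sumˡ-applyUpTo h (suc n) = ≡.cong (h 0 ∙_) (sumˡ-applyUpTo (λ i → h (suc i)) n)

  sumˡ-map-upTo : ∀ h n → sumˡ (map h (upTo n)) ≡ sumBelow h n
  sumˡ-map-upTo h n = ≡.trans (≡.cong sumˡ (map-upTo h n)) (sumˡ-applyUpTo h n)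

  sumBelow-cong : ∀ {h h'} n → (∀ i → i < n → h i ≈ h' i) → sumBelow h n ≈ sumBelow h' n
  sumBelow-cong zero    p = refl
  sumBelow-cong (suc n) p = ∙-cong (p 0 (s≤s z≤n)) (sumBelow-cong n (λ i i<n → p (suc i) (s≤s i<n)))

  sumBelow-suc : ∀ h n → sumBelow h (suc n) ≈ sumBelow h n ∙ h n
  sumBelow-suc h zero    = trans (identityʳ (h 0)) (sym (identityˡ (h 0)))
  sumBelow-suc h (suc n) = trans (∙-congˡ (sumBelow-suc (λ i → h (suc i)) n)) (sym (assoc _ _ _))

  sumBelow-∙ : ∀ h h' n → sumBelow (λ i → h i ∙ h' i) n ≈ sumBelow h n ∙ sumBelow h' n
  sumBelow-∙ h h' zero    = sym (identityˡ ε)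
  sumBelow-∙ h h' (suc n) =
    trans (∙-congˡ (sumBelow-∙ (λ i → h (suc i)) (λ i → h' (suc i)) n)) (interchange _ _ _ _)

  sumBelow-ε : ∀ {h} n → (∀ i → i < n → h i ≈ ε) → sumBelow h n ≈ ε
  sumBelow-ε zero    p = refl
  sumBelow-ε (suc n) p =
    trans (∙-cong (p 0 (s≤s z≤n)) (sumBelow-ε n (λ i i<n → p (suc i) (s≤s i<n)))) (identityˡ ε)

  sumBelow-single : ∀ {h} n j → j < n → (∀ k → k < n → ¬ k ≡ j → h k ≈ ε) → sumBelow h n ≈ h j
  sumBelow-single (suc n) zero    _         p =
    trans (∙-congˡ (sumBelow-ε n (λ i i<n → p (suc i) (s≤s i<n) (λ ())))) (identityʳ _)
  sumBelow-single (suc n) (suc j) (s≤s j<n) p =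
    trans (∙-cong (p 0 (s≤s z≤n) (λ ()))
                  (sumBelow-single n j j<n (λ k k<n k≢j → p (suc k) (s≤s k<n) (λ { ≡.refl → k≢j ≡.refl }))))
          (identityˡ _)

  sumˡ-++ : ∀ xs ys → sumˡ (xs ++ ys) ≈ sumˡ xs ∙ sumˡ ys
  sumˡ-++ []       ys = sym (identityˡ _)
  sumˡ-++ (x ∷ xs) ys = trans (∙-congˡ (sumˡ-++ xs ys)) (sym (assoc _ _ _))

  module _ {A : Set} where

    sumˡ-map-congᴬ : ∀ {P : A → Set} {f g : A → Carrier} {xs} →
                     All P xs → (∀ x → P x → f x ≈ g x) → sumˡ (map f xs) ≈ sumˡ (map g xs)
    sumˡ-map-congᴬ []         p = refl
    sumˡ-map-congᴬ (px ∷ pxs) p = ∙-cong (p _ px) (sumˡ-map-congᴬ pxs p)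

    sumˡ-map-cong : ∀ {f g : A → Carrier} xs → (∀ x → f x ≈ g x) → sumˡ (map f xs) ≈ sumˡ (map g xs)
    sumˡ-map-cong []       p = refl
    sumˡ-map-cong (x ∷ xs) p = ∙-cong (p x) (sumˡ-map-cong xs p)

    sumˡ-map-ε : ∀ {f : A → Carrier} xs → (∀ x → f x ≈ ε) → sumˡ (map f xs) ≈ ε
    sumˡ-map-ε []       p = refl
    sumˡ-map-ε (x ∷ xs) p = trans (∙-cong (p x) (sumˡ-map-ε xs p)) (identityˡ ε)

    sumˡ-map-∙ : ∀ (f g : A → Carrier) xs → sumˡ (map (λ x → f x ∙ g x) xs) ≈ sumˡ (map f xs) ∙ sumˡ (map g xs)
    sumˡ-map-∙ f g []       = sym (identityˡ ε)
    sumˡ-map-∙ f g (x ∷ xs) = trans (∙-congˡ (sumˡ-map-∙ f g xs)) (interchange _ _ _ _)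

    sumˡ-map-homo : ∀ (h : Carrier → Carrier) → (∀ {x y} → x ≈ y → h x ≈ h y) → h ε ≈ ε →
                    (∀ x y → h (x ∙ y) ≈ h x ∙ h y) →
                    ∀ (f : A → Carrier) xs → sumˡ (map (λ x → h (f x)) xs) ≈ h (sumˡ (map f xs))
    sumˡ-map-homo h h-cong h-ε h-∙ f []       = sym h-ε
    sumˡ-map-homo h h-cong h-ε h-∙ f (x ∷ xs) =
      trans (∙-congˡ (sumˡ-map-homo h h-cong h-ε h-∙ f xs)) (sym (h-∙ (f x) _))

    sumˡ-sumBelow-comm : ∀ (G : ℕ → A → Carrier) n xs →
                         sumˡ (map (λ x → sumBelow (λ k → G k x) n) xs) ≈ sumBelow (λ k → sumˡ (map (G k) xs)) n
    sumˡ-sumBelow-comm G zero    xs = sumˡ-map-ε xs (λ _ → refl)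
    sumˡ-sumBelow-comm G (suc n) xs =
      trans (sumˡ-map-∙ (G 0) (λ x → sumBelow (λ k → G (suc k) x) n) xs)
            (∙-congˡ (sumˡ-sumBelow-comm (λ k → G (suc k)) n xs))

  module _ {A B : Set} where

    sumˡ-map-map : ∀ (φ : B → Carrier) (g : A → B) xs → sumˡ (map φ (map g xs)) ≡ sumˡ (map (λ x → φ (g x)) xs)
    sumˡ-map-map φ g []       = ≡.refl
    sumˡ-map-map φ g (x ∷ xs) = ≡.cong (φ (g x) ∙_) (sumˡ-map-map φ g xs)

    sumˡ-concatMap : ∀ (φ : B → Carrier) (h : A → List B) xs →
                     sumˡ (map φ (concatMap h xs)) ≈ sumˡ (map (λ x → sumˡ (map φ (h x))) xs)
    sumˡ-concatMap φ h []       = refl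
    sumˡ-concatMap φ h (x ∷ xs) = begin
      sumˡ (map φ (h x ++ concatMap h xs))                ≡⟨ ≡.cong sumˡ (map-++ φ (h x) (concatMap h xs)) ⟩
      sumˡ (map φ (h x) ++ map φ (concatMap h xs))        ≈⟨ sumˡ-++ (map φ (h x)) _ ⟩
      sumˡ (map φ (h x)) ∙ sumˡ (map φ (concatMap h xs))  ≈⟨ ∙-congˡ (sumˡ-concatMap φ h xs) ⟩
      sumˡ (map φ (h x)) ∙ sumˡ (map (λ x → sumˡ (map φ (h x))) xs) ∎

module NatRational where

  import Data.Nat as ℕ
  open import Data.Integer using (+_)
  open import Data.Rational using (ℚ; 0ℚ; 1ℚ; _+_; _*_; _/_; toℚᵘ)
  open import Data.Rational.Unnormalised as ℚᵘ using (mkℚᵘ; *≡*)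
  import Data.Rational.Unnormalised.Properties as ℚᵘ
  open import Data.Rational.Properties
  open import Data.Integer.Solver using (module +-*-Solver)
  open import Relation.Binary.PropositionalEquality

  natℚ-+ : ∀ a b → natℚ (a ℕ.+ b) ≡ natℚ a + natℚ b
  natℚ-+ a b = toℚᵘ-injective (begin
    toℚᵘ (natℚ (a ℕ.+ b))                ≈⟨ toℚᵘ-fromℚᵘ (mkℚᵘ (+ (a ℕ.+ b)) 0) ⟩
    mkℚᵘ (+ (a ℕ.+ b)) 0                 ≈⟨ *≡* (solve 2 (λ x y → (x :+ y) :* con (+ 1) := (x :* con (+ 1) :+ y :* con (+ 1)) :* con (+ 1)) refl (+ a) (+ b)) ⟩
    mkℚᵘ (+ a) 0 ℚᵘ.+ mkℚᵘ (+ b) 0       ≈⟨ ℚᵘ.≃-sym (ℚᵘ.+-cong (toℚᵘ-fromℚᵘ (mkℚᵘ (+ a) 0)) (toℚᵘ-fromℚᵘ (mkℚᵘ (+ b) 0))) ⟩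
    toℚᵘ (natℚ a) ℚᵘ.+ toℚᵘ (natℚ b)     ≈⟨ ℚᵘ.≃-sym (toℚᵘ-homo-+ (natℚ a) (natℚ b)) ⟩
    toℚᵘ (natℚ a + natℚ b)               ∎)
    where
    open +-*-Solver
    open import Relation.Binary.Reasoning.Setoid ℚᵘ.≃-setoid

  natℚ-*-inverse : ∀ m → natℚ (suc m) * ((+ 1) / suc m) ≡ 1ℚ
  natℚ-*-inverse m = toℚᵘ-injective
    (ℚᵘ.≃-trans (toℚᵘ-homo-* (natℚ (suc m)) ((+ 1) / suc m))
      (ℚᵘ.≃-trans (ℚᵘ.*-cong (toℚᵘ-fromℚᵘ (mkℚᵘ (+ suc m) 0)) (toℚᵘ-fromℚᵘ (mkℚᵘ (+ 1) m)))
        (ℚᵘ.*-inverseʳ (mkℚᵘ (+ suc m) 0))))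

  natℚ-suc-*-cancel : ∀ m x → natℚ (suc m) * x ≡ 0ℚ → x ≡ 0ℚ
  natℚ-suc-*-cancel m x eq = begin
    x                                     ≡⟨ sym (*-identityˡ x) ⟩
    1ℚ * x                                ≡⟨ cong (_* x) (sym (natℚ-*-inverse m)) ⟩
    (natℚ (suc m) * ((+ 1) / suc m)) * x  ≡⟨ cong (_* x) (*-comm (natℚ (suc m)) _) ⟩
    (((+ 1) / suc m) * natℚ (suc m)) * x  ≡⟨ *-assoc ((+ 1) / suc m) _ x ⟩
    ((+ 1) / suc m) * (natℚ (suc m) * x)  ≡⟨ cong (((+ 1) / suc m) *_) eq ⟩
    ((+ 1) / suc m) * 0ℚ                  ≡⟨ *-zeroʳ ((+ 1) / suc m) ⟩
    0ℚ                                    ∎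
    where open ≡-Reasoning

-- An exponential generating function f stands for Σ f n xⁿ/n!; the product
-- is then determined by f ⊙ g at 0 and the Leibniz rule ∂(f ⊙ g) = ∂f ⊙ g + f ⊙ ∂g.
module ExponentialSeries where

  open import Data.Rational using (ℚ; 0ℚ; 1ℚ; _+_; _*_; -_)
  open import Data.Bool using (true; false; if_then_else_)
  open import Data.Rational.Properties
  open import Data.Rational.Solver using (module +-*-Solver)
  open import Algebra.Properties.Group +-0-group using (⁻¹-involutive)
  open import Relation.Binary.PropositionalEquality
  open +-*-Solver using (solve; _:+_; _:*_; :-_; _:=_; con)
  open NatRational

  EGF : Set
  EGF = ℕ → ℚ

  infixl 6 _⊕_
  infixl 7 _⊙_
  infix  8 ⊖_

  ∂ : EGF → EGF
  ∂ f n = f (suc n)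

  _⊕_ : EGF → EGF → EGF
  (f ⊕ g) n = f n + g n

  ⊖_ : EGF → EGF
  (⊖ f) n = - f n

  𝟘 𝟙 exp expm1 X : EGF
  𝟘 _ = 0ℚ

  𝟙 zero    = 1ℚ
  𝟙 (suc _) = 0ℚ

  exp _ = 1ℚ

  expm1 zero    = 0ℚ
  expm1 (suc _) = 1ℚ

  X zero    = 0ℚ
  X (suc n) = 𝟙 n

  _⊙_ : EGF → EGF → EGF
  (f ⊙ g) zero    = f 0 * g 0
  (f ⊙ g) (suc n) = (∂ f ⊙ g) n + (f ⊙ ∂ g) n

  ⊙-cong : ∀ {f f' g g'} → f ≗ f' → g ≗ g' → f ⊙ g ≗ f' ⊙ g'
  ⊙-cong pf pg zero    = cong₂ _*_ (pf 0) (pg 0)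
  ⊙-cong pf pg (suc n) = cong₂ _+_ (⊙-cong (λ i → pf (suc i)) pg n) (⊙-cong pf (λ i → pg (suc i)) n)

  ⊙-comm : ∀ f g → f ⊙ g ≗ g ⊙ f
  ⊙-comm f g zero    = *-comm (f 0) (g 0)
  ⊙-comm f g (suc n) = trans (cong₂ _+_ (⊙-comm (∂ f) g n) (⊙-comm f (∂ g) n)) (+-comm ((g ⊙ ∂ f) n) ((∂ g ⊙ f) n))

  ⊙-distribʳ-⊕ : ∀ g f f' → (f ⊕ f') ⊙ g ≗ f ⊙ g ⊕ f' ⊙ g
  ⊙-distribʳ-⊕ g f f' zero    = *-distribʳ-+ (g 0) (f 0) (f' 0)
  ⊙-distribʳ-⊕ g f f' (suc n) =
    trans (cong₂ _+_ (⊙-distribʳ-⊕ g (∂ f) (∂ f') n) (⊙-distribʳ-⊕ (∂ g) f f' n))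
          (interchange ((∂ f ⊙ g) n) _ _ _)
    where
    interchange : ∀ a b c d → (a + b) + (c + d) ≡ (a + c) + (b + d)
    interchange = solve 4 (λ a b c d → (a :+ b) :+ (c :+ d) := (a :+ c) :+ (b :+ d)) refl

  ⊙-distribˡ-⊕ : ∀ f g g' → f ⊙ (g ⊕ g') ≗ f ⊙ g ⊕ f ⊙ g'
  ⊙-distribˡ-⊕ f g g' n = trans (⊙-comm f _ n) (trans (⊙-distribʳ-⊕ f g g' n)
                            (cong₂ _+_ (⊙-comm g f n) (⊙-comm g' f n)))

  ⊙-negˡ : ∀ f g → ⊖ f ⊙ g ≗ ⊖ (f ⊙ g)
  ⊙-negˡ f g zero    = sym (neg-distribˡ-* (f 0) (g 0))
  ⊙-negˡ f g (suc n) = trans (cong₂ _+_ (⊙-negˡ (∂ f) g n) (⊙-negˡ f (∂ g) n))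
                             (sym (neg-distrib-+ ((∂ f ⊙ g) n) _))

  ⊙-negʳ : ∀ f g → f ⊙ ⊖ g ≗ ⊖ (f ⊙ g)
  ⊙-negʳ f g n = trans (⊙-comm f _ n) (trans (⊙-negˡ g f n) (cong -_ (⊙-comm g f n)))

  ⊙-zeroˡ : ∀ g → 𝟘 ⊙ g ≗ 𝟘
  ⊙-zeroˡ g zero    = *-zeroˡ (g 0)
  ⊙-zeroˡ g (suc n) = cong₂ _+_ (⊙-zeroˡ g n) (⊙-zeroˡ (∂ g) n)

  ⊙-zeroʳ : ∀ f → f ⊙ 𝟘 ≗ 𝟘
  ⊙-zeroʳ f n = trans (⊙-comm f _ n) (⊙-zeroˡ f n)

  ⊙-identityʳ : ∀ f → f ⊙ 𝟙 ≗ f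
  ⊙-identityʳ f zero    = *-identityʳ (f 0)
  ⊙-identityʳ f (suc n) = trans (cong₂ _+_ (⊙-identityʳ (∂ f) n) (⊙-zeroʳ f n)) (+-identityʳ _)

  ⊙-assoc : ∀ f g h → (f ⊙ g) ⊙ h ≗ f ⊙ (g ⊙ h)
  ⊙-assoc f g h zero    = *-assoc (f 0) (g 0) (h 0)
  ⊙-assoc f g h (suc n) = begin
    ((∂ f ⊙ g ⊕ f ⊙ ∂ g) ⊙ h) n + ((f ⊙ g) ⊙ ∂ h) n
      ≡⟨ cong (_+ ((f ⊙ g) ⊙ ∂ h) n) (⊙-distribʳ-⊕ h (∂ f ⊙ g) (f ⊙ ∂ g) n) ⟩
    (((∂ f ⊙ g) ⊙ h) n + ((f ⊙ ∂ g) ⊙ h) n) + ((f ⊙ g) ⊙ ∂ h) n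
      ≡⟨ cong₂ _+_ (cong₂ _+_ (⊙-assoc (∂ f) g h n) (⊙-assoc f (∂ g) h n)) (⊙-assoc f g (∂ h) n) ⟩
    ((∂ f ⊙ (g ⊙ h)) n + (f ⊙ (∂ g ⊙ h)) n) + (f ⊙ (g ⊙ ∂ h)) n
      ≡⟨ +-assoc ((∂ f ⊙ (g ⊙ h)) n) _ _ ⟩
    (∂ f ⊙ (g ⊙ h)) n + ((f ⊙ (∂ g ⊙ h)) n + (f ⊙ (g ⊙ ∂ h)) n)
      ≡⟨ cong ((∂ f ⊙ (g ⊙ h)) n +_) (sym (⊙-distribˡ-⊕ f (∂ g ⊙ h) (g ⊙ ∂ h) n)) ⟩
    (∂ f ⊙ (g ⊙ h)) n + (f ⊙ ∂ (g ⊙ h)) n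
      ∎
    where open ≡-Reasoning

  ⊙-X-suc : ∀ f n → (f ⊙ X) (suc n) ≡ natℚ (suc n) * f n
  ⊙-X-suc f zero    = solve 2 (λ a b → a :* con 0ℚ :+ b :* con 1ℚ := con 1ℚ :* b) refl (f 1) (f 0)
  ⊙-X-suc f (suc n) = begin
    (∂ f ⊙ X) (suc n) + (f ⊙ 𝟙) (suc n)        ≡⟨ cong₂ _+_ (⊙-X-suc (∂ f) n) (⊙-identityʳ f (suc n)) ⟩
    natℚ (suc n) * f (suc n) + f (suc n)       ≡⟨ solve 2 (λ a b → a :* b :+ b := (con 1ℚ :+ a) :* b) refl (natℚ (suc n)) (f (suc n)) ⟩
    (1ℚ + natℚ (suc n)) * f (suc n)            ≡⟨ cong (_* f (suc n)) (sym (natℚ-+ 1 (suc n))) ⟩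
    natℚ (suc (suc n)) * f (suc n)             ∎
    where open ≡-Reasoning

  ⊙-X-cancel : ∀ f → f ⊙ X ≗ 𝟘 → f ≗ 𝟘
  ⊙-X-cancel f fX≗𝟘 n = natℚ-suc-*-cancel n (f n) (trans (sym (⊙-X-suc f n)) (fX≗𝟘 (suc n)))

  -- reflect f is f(−x).
  signed : ℕ → ℚ → ℚ
  signed zero    q = q
  signed (suc n) q = - signed n q

  reflect : EGF → EGF
  reflect f n = signed n (f n)

  signed-+ : ∀ n p q → signed n (p + q) ≡ signed n p + signed n q
  signed-+ zero    p q = refl
  signed-+ (suc n) p q = trans (cong -_ (signed-+ n p q)) (neg-distrib-+ (signed n p) (signed n q))

  signed-parity : ∀ n q → signed n q ≡ (if oddB n then - q else q)
  signed-parity zero    q = refl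
  signed-parity (suc n) q with oddB n | signed-parity n q
  ... | true  | eq = trans (cong -_ eq) (⁻¹-involutive q)
  ... | false | eq = cong -_ eq

  reflect-⊙ : ∀ f g → reflect f ⊙ reflect g ≗ reflect (f ⊙ g)
  reflect-⊙ f g zero    = refl
  reflect-⊙ f g (suc n) = begin
    (⊖ reflect (∂ f) ⊙ reflect g) n + (reflect f ⊙ ⊖ reflect (∂ g)) n
      ≡⟨ cong₂ _+_ (⊙-negˡ (reflect (∂ f)) (reflect g) n) (⊙-negʳ (reflect f) (reflect (∂ g)) n) ⟩
    - (reflect (∂ f) ⊙ reflect g) n + - (reflect f ⊙ reflect (∂ g)) n
      ≡⟨ cong₂ (λ u v → - u + - v) (reflect-⊙ (∂ f) g n) (reflect-⊙ f (∂ g) n) ⟩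
    - signed n ((∂ f ⊙ g) n) + - signed n ((f ⊙ ∂ g) n)
      ≡⟨ sym (neg-distrib-+ (signed n ((∂ f ⊙ g) n)) _) ⟩
    - (signed n ((∂ f ⊙ g) n) + signed n ((f ⊙ ∂ g) n))
      ≡⟨ cong -_ (sym (signed-+ n ((∂ f ⊙ g) n) _)) ⟩
    - signed n ((∂ f ⊙ g) n + (f ⊙ ∂ g) n)
      ∎
    where open ≡-Reasoning

  reflect-X : reflect X ≗ ⊖ X
  reflect-X zero          = refl
  reflect-X (suc zero)    = refl
  reflect-X (suc (suc n)) = signed-0 (suc (suc n))
    where
    signed-0 : ∀ n → signed n 0ℚ ≡ 0ℚ
    signed-0 zero    = refl
    signed-0 (suc n) = cong -_ (signed-0 n)

  exp-⊙-reflect-exp : exp ⊙ reflect exp ≗ 𝟙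
  exp-⊙-reflect-exp zero    = refl
  exp-⊙-reflect-exp (suc n) =
    trans (cong ((exp ⊙ reflect exp) n +_) (⊙-negʳ exp (reflect exp) n)) (+-inverseʳ ((exp ⊙ reflect exp) n))

  expm1≗exp⊖𝟙 : expm1 ≗ exp ⊕ ⊖ 𝟙
  expm1≗exp⊖𝟙 zero    = refl
  expm1≗exp⊖𝟙 (suc n) = refl

  exp⊖expm1≗𝟙 : exp ⊕ ⊖ expm1 ≗ 𝟙
  exp⊖expm1≗𝟙 zero    = refl
  exp⊖expm1≗𝟙 (suc n) = refl

  exp-⊙-reflect-expm1 : exp ⊙ reflect expm1 ≗ ⊖ expm1
  exp-⊙-reflect-expm1 n = begin
    (exp ⊙ reflect expm1) n                   ≡⟨ ⊙-cong (λ _ → refl) reflect-expm1 n ⟩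
    (exp ⊙ (reflect exp ⊕ ⊖ 𝟙)) n            ≡⟨ ⊙-distribˡ-⊕ exp (reflect exp) (⊖ 𝟙) n ⟩
    (exp ⊙ reflect exp) n + (exp ⊙ ⊖ 𝟙) n    ≡⟨ cong₂ _+_ (exp-⊙-reflect-exp n) (trans (⊙-negʳ exp 𝟙 n) (cong -_ (⊙-identityʳ exp n))) ⟩
    𝟙 n + - 1ℚ                                ≡⟨ solve 2 (λ a b → a :+ :- b := :- (b :+ :- a)) refl (𝟙 n) 1ℚ ⟩
    - (1ℚ + - 𝟙 n)                            ≡⟨ cong -_ (sym (expm1≗exp⊖𝟙 n)) ⟩
    - expm1 n                                 ∎
    where
    open ≡-Reasoning
    reflect-expm1 : reflect expm1 ≗ reflect exp ⊕ ⊖ 𝟙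
    reflect-expm1 zero    = refl
    reflect-expm1 (suc n) = sym (+-identityʳ _)

module BernoulliNumbers where

  import Data.Nat as ℕ
  import Data.Nat.Properties as ℕ
  open import Data.Nat.Combinatorics using (_C_; nCk+nC[k+1]≡[n+1]C[k+1]; k>n⇒nCk≡0; nCn≡1; nC1≡n; nCk≡nC[n∸k])
  import Data.Integer as ℤ
  open import Data.Rational using (ℚ; 0ℚ; 1ℚ; _+_; _*_; -_; _/_)
  open import Data.Rational.Properties
  open import Data.Rational.Solver using (module +-*-Solver)
  open import Data.Bool using (true; false; if_then_else_)
  open import Data.Bool.Properties using (∧-conicalˡ)
  open import Data.List using (List; []; _∷_; map; upTo; reverse; zipWith; _∷ʳ_; length)
  open import Data.List.Properties using (unfold-reverse; upTo-∷ʳ; map-++)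
  open import Relation.Binary.PropositionalEquality
  open +-*-Solver using (solve; _:+_; _:*_; :-_; _:=_; con)
  open NatRational
  open ExponentialSeries
  open FiniteSums +-0-commutativeMonoid using (sumBelow; sumBelow-cong; sumBelow-suc; sumBelow-∙; sumˡ-map-upTo)

  -- b = x / (eˣ − 1), so b(−x) = b(x) + x: the odd part of b is −x/2.
  module XOverExpm1 (b : EGF) (b⊙expm1≗X : b ⊙ expm1 ≗ X) where

    reflect-b⊙expm1≗exp⊙X : reflect b ⊙ expm1 ≗ exp ⊙ X
    reflect-b⊙expm1≗exp⊙X n = begin
      (reflect b ⊙ expm1) n                           ≡⟨ ⊙-cong (λ _ → refl) expm1≗⊖exp⊙reflect-expm1 n ⟩
      (reflect b ⊙ ⊖ (exp ⊙ reflect expm1)) n         ≡⟨ ⊙-negʳ (reflect b) (exp ⊙ reflect expm1) n ⟩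
      - (reflect b ⊙ (exp ⊙ reflect expm1)) n         ≡⟨ cong -_ (sym (⊙-assoc (reflect b) exp (reflect expm1) n)) ⟩
      - ((reflect b ⊙ exp) ⊙ reflect expm1) n         ≡⟨ cong -_ (⊙-cong (⊙-comm (reflect b) exp) (λ _ → refl) n) ⟩
      - ((exp ⊙ reflect b) ⊙ reflect expm1) n         ≡⟨ cong -_ (⊙-assoc exp (reflect b) (reflect expm1) n) ⟩
      - (exp ⊙ (reflect b ⊙ reflect expm1)) n         ≡⟨ cong -_ (⊙-cong (λ _ → refl) reflect-b⊙reflect-expm1 n) ⟩
      - (exp ⊙ ⊖ X) n                                 ≡⟨ cong -_ (⊙-negʳ exp X n) ⟩
      - - (exp ⊙ X) n                                 ≡⟨ ⁻¹-involutive ((exp ⊙ X) n) ⟩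
      (exp ⊙ X) n                                     ∎
      where
      open ≡-Reasoning
      open import Algebra.Properties.Group +-0-group using (⁻¹-involutive)
      expm1≗⊖exp⊙reflect-expm1 : expm1 ≗ ⊖ (exp ⊙ reflect expm1)
      expm1≗⊖exp⊙reflect-expm1 i = trans (sym (⁻¹-involutive (expm1 i))) (cong -_ (sym (exp-⊙-reflect-expm1 i)))
      reflect-b⊙reflect-expm1 : reflect b ⊙ reflect expm1 ≗ ⊖ X
      reflect-b⊙reflect-expm1 i = trans (reflect-⊙ b expm1 i) (trans (cong (signed i) (b⊙expm1≗X i)) (reflect-X i))

    reflect-b⊖b⊖X⊙expm1≗𝟘 : (reflect b ⊕ ⊖ b ⊕ ⊖ X) ⊙ expm1 ≗ 𝟘
    reflect-b⊖b⊖X⊙expm1≗𝟘 n = begin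
      ((reflect b ⊕ ⊖ b ⊕ ⊖ X) ⊙ expm1) n
        ≡⟨ ⊙-distribʳ-⊕ expm1 (reflect b ⊕ ⊖ b) (⊖ X) n ⟩
      ((reflect b ⊕ ⊖ b) ⊙ expm1) n + (⊖ X ⊙ expm1) n
        ≡⟨ cong₂ _+_ (⊙-distribʳ-⊕ expm1 (reflect b) (⊖ b) n) (⊙-negˡ X expm1 n) ⟩
      ((reflect b ⊙ expm1) n + (⊖ b ⊙ expm1) n) + - (X ⊙ expm1) n
        ≡⟨ cong₂ (λ u v → (u + v) + - (X ⊙ expm1) n)
                 (trans (reflect-b⊙expm1≗exp⊙X n) (⊙-comm exp X n))
                 (trans (⊙-negˡ b expm1 n) (cong -_ (b⊙expm1≗X n))) ⟩
      ((X ⊙ exp) n + - X n) + - (X ⊙ expm1) n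
        ≡⟨ solve 3 (λ p q r → (p :+ :- q) :+ :- r := (p :+ :- r) :+ :- q) refl ((X ⊙ exp) n) (X n) _ ⟩
      ((X ⊙ exp) n + - (X ⊙ expm1) n) + - X n
        ≡⟨ cong (_+ - X n) (sym (trans (⊙-distribˡ-⊕ X exp (⊖ expm1) n) (cong ((X ⊙ exp) n +_) (⊙-negʳ X expm1 n)))) ⟩
      (X ⊙ (exp ⊕ ⊖ expm1)) n + - X n
        ≡⟨ cong (_+ - X n) (trans (⊙-cong (λ _ → refl) exp⊖expm1≗𝟙 n) (⊙-identityʳ X n)) ⟩
      X n + - X n
        ≡⟨ +-inverseʳ (X n) ⟩
      0ℚ ∎
      where open ≡-Reasoning

    reflect-b⊖b⊖X≗𝟘 : reflect b ⊕ ⊖ b ⊕ ⊖ X ≗ 𝟘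
    reflect-b⊖b⊖X≗𝟘 = ⊙-X-cancel d d⊙X≗𝟘
      where
      d = reflect b ⊕ ⊖ b ⊕ ⊖ X
      d⊙X≗𝟘 : d ⊙ X ≗ 𝟘
      d⊙X≗𝟘 n = begin
        (d ⊙ X) n              ≡⟨ ⊙-cong (λ _ → refl) (λ i → trans (sym (b⊙expm1≗X i)) (⊙-comm b expm1 i)) n ⟩
        (d ⊙ (expm1 ⊙ b)) n    ≡⟨ sym (⊙-assoc d expm1 b n) ⟩
        ((d ⊙ expm1) ⊙ b) n    ≡⟨ ⊙-cong reflect-b⊖b⊖X⊙expm1≗𝟘 (λ _ → refl) n ⟩
        (𝟘 ⊙ b) n              ≡⟨ ⊙-zeroˡ b n ⟩
        0ℚ                     ∎
        where open ≡-Reasoning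

    odd-coefficient≡0 : ∀ n → oddB (suc (suc n)) ≡ true → b (suc (suc n)) ≡ 0ℚ
    odd-coefficient≡0 n odd = natℚ-suc-*-cancel 1 y (begin
      natℚ 2 * y                                  ≡⟨ solve 1 (λ y → con (natℚ 2) :* y := :- (:- y :+ :- y :+ :- con 0ℚ)) refl y ⟩
      - (- y + - y + - 0ℚ)                        ≡⟨ cong (λ u → - (u + - y + - 0ℚ)) (sym reflect-b≡-y) ⟩
      - (reflect b ⊕ ⊖ b ⊕ ⊖ X) (suc (suc n))     ≡⟨ cong -_ (reflect-b⊖b⊖X≗𝟘 (suc (suc n))) ⟩
      0ℚ                                          ∎)
      where
      open ≡-Reasoning
      y = b (suc (suc n))
      reflect-b≡-y : reflect b (suc (suc n)) ≡ - y
      reflect-b≡-y = trans (signed-parity (suc (suc n)) y) (cong (λ o → if o then - y else y) odd)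

  ⊙-exp-binomial : ∀ f n → (f ⊙ exp) n ≡ sumBelow (λ j → natℚ (n C j) * f j) (suc n)
  ⊙-exp-binomial f zero    = trans (*-comm (f 0) 1ℚ) (sym (+-identityʳ (1ℚ * f 0)))
  ⊙-exp-binomial f (suc n) = begin
    (∂ f ⊙ exp) n + (f ⊙ exp) n
      ≡⟨ cong₂ _+_ (⊙-exp-binomial (∂ f) n) (⊙-exp-binomial f n) ⟩
    sumBelow lower (suc n) + sumBelow unshifted (suc n)
      ≡⟨ cong (sumBelow lower (suc n) +_) unshifted-peel ⟩
    sumBelow lower (suc n) + (f 0 + sumBelow upper (suc n))
      ≡⟨ solve 3 (λ p q r → p :+ (q :+ r) := q :+ (p :+ r)) refl (sumBelow lower (suc n)) (f 0) _ ⟩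
    f 0 + (sumBelow lower (suc n) + sumBelow upper (suc n))
      ≡⟨ cong₂ _+_ (sym (*-identityˡ (f 0))) (sym (sumBelow-∙ lower upper (suc n))) ⟩
    1ℚ * f 0 + sumBelow (λ j → lower j + upper j) (suc n)
      ≡⟨ cong (1ℚ * f 0 +_) (sumBelow-cong (suc n) (λ j _ → pascal j)) ⟩
    1ℚ * f 0 + sumBelow (λ j → natℚ (suc n C suc j) * f (suc j)) (suc n)
      ∎
    where
    open ≡-Reasoning
    unshifted lower upper : ℕ → ℚ
    unshifted j = natℚ (n C j) * f j
    lower j     = natℚ (n C j) * f (suc j)
    upper j     = natℚ (n C suc j) * f (suc j)
    pascal : ∀ j → lower j + upper j ≡ natℚ (suc n C suc j) * f (suc j)
    pascal j = trans (sym (*-distribʳ-+ (f (suc j)) (natℚ (n C j)) (natℚ (n C suc j))))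
                     (cong (_* f (suc j)) (trans (sym (natℚ-+ (n C j) (n C suc j)))
                                                 (cong natℚ (nCk+nC[k+1]≡[n+1]C[k+1] n j))))
    unshifted-peel : sumBelow unshifted (suc n) ≡ f 0 + sumBelow upper (suc n)
    unshifted-peel = begin
      sumBelow unshifted (suc n)                       ≡⟨ sym (+-identityʳ _) ⟩
      sumBelow unshifted (suc n) + 0ℚ                  ≡⟨ cong (sumBelow unshifted (suc n) +_) (sym unshifted-last) ⟩
      sumBelow unshifted (suc n) + unshifted (suc n)   ≡⟨ sym (sumBelow-suc unshifted (suc n)) ⟩
      natℚ 1 * f 0 + sumBelow upper (suc n)            ≡⟨ cong (_+ sumBelow upper (suc n)) (*-identityˡ (f 0)) ⟩
      f 0 + sumBelow upper (suc n)                     ∎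
      where
      unshifted-last : unshifted (suc n) ≡ 0ℚ
      unshifted-last = trans (cong (λ k → natℚ k * f (suc n)) (k>n⇒nCk≡0 {n} {suc n} ℕ.≤-refl)) (*-zeroˡ (f (suc n)))

  ⊙-expm1-binomial : ∀ f n → (f ⊙ expm1) n ≡ sumBelow (λ j → natℚ (n C j) * f j) n
  ⊙-expm1-binomial f n = begin
    (f ⊙ expm1) n                      ≡⟨ ⊙-cong (λ _ → refl) expm1≗exp⊖𝟙 n ⟩
    (f ⊙ (exp ⊕ ⊖ 𝟙)) n                ≡⟨ ⊙-distribˡ-⊕ f exp (⊖ 𝟙) n ⟩
    (f ⊙ exp) n + (f ⊙ ⊖ 𝟙) n          ≡⟨ cong₂ _+_ (⊙-exp-binomial f n) (trans (⊙-negʳ f 𝟙 n) (cong -_ (⊙-identityʳ f n))) ⟩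
    sumBelow term (suc n) + - f n      ≡⟨ cong (_+ - f n) (sumBelow-suc term n) ⟩
    (sumBelow term n + term n) + - f n ≡⟨ cong (λ u → (sumBelow term n + u) + - f n) term-last ⟩
    (sumBelow term n + f n) + - f n    ≡⟨ solve 2 (λ p q → (p :+ q) :+ :- q := p) refl (sumBelow term n) (f n) ⟩
    sumBelow term n                    ∎
    where
    open ≡-Reasoning
    term : ℕ → ℚ
    term j = natℚ (n C j) * f j
    term-last : term n ≡ f n
    term-last = trans (cong (λ k → natℚ k * f n) (nCn≡1 n)) (*-identityˡ (f n))

  reverse-bernRev : ∀ n → reverse (bernRev n) ≡ map bernoulli (upTo (suc n))
  reverse-bernRev zero    = refl
  reverse-bernRev (suc n) = begin
    reverse (bernoulli (suc n) ∷ bernRev n)                 ≡⟨ unfold-reverse (bernoulli (suc n)) (bernRev n) ⟩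
    reverse (bernRev n) ∷ʳ bernoulli (suc n)                ≡⟨ cong (_∷ʳ bernoulli (suc n)) (reverse-bernRev n) ⟩
    map bernoulli (upTo (suc n)) ∷ʳ bernoulli (suc n)       ≡⟨ sym (map-++ bernoulli (upTo (suc n)) (suc n ∷ [])) ⟩
    map bernoulli (upTo (suc n) ∷ʳ suc n)                   ≡⟨ cong (map bernoulli) (upTo-∷ʳ (suc n)) ⟩
    map bernoulli (upTo (suc (suc n)))                      ∎
    where open ≡-Reasoning

  zipWith-map : ∀ (g : ℕ → ℚ → ℚ) xs → zipWith g xs (map bernoulli xs) ≡ map (λ j → g j (bernoulli j)) xs
  zipWith-map g []       = refl
  zipWith-map g (x ∷ xs) = cong (g x (bernoulli x) ∷_) (zipWith-map g xs)

  bernoulli⊙expm1≗X : bernoulli ⊙ expm1 ≗ X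
  bernoulli⊙expm1≗X zero          = refl
  bernoulli⊙expm1≗X (suc zero)    = ⊙-expm1-binomial bernoulli 1
  bernoulli⊙expm1≗X (suc (suc n)) = begin
    (bernoulli ⊙ expm1) (suc (suc n))       ≡⟨ ⊙-expm1-binomial bernoulli (suc (suc n)) ⟩
    sumBelow term (suc (suc n))             ≡⟨ sumBelow-suc term (suc n) ⟩
    sumBelow term (suc n) + term (suc n)    ≡⟨ cong₂ _+_ (sym recurrence-sum) term-last ⟩
    T + N * bernoulli (suc n)               ≡⟨⟩  -- the recurrence defining bernRev
    T + N * - (N⁻¹ * T)                     ≡⟨ solve 3 (λ N I T → T :+ N :* (:- (I :* T)) := T :+ :- ((N :* I) :* T)) refl N N⁻¹ T ⟩
    T + - ((N * N⁻¹) * T)                   ≡⟨ cong (λ u → T + - (u * T)) (natℚ-*-inverse (suc n)) ⟩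
    T + - (1ℚ * T)                          ≡⟨ cong (λ u → T + - u) (*-identityˡ T) ⟩
    T + - T                                 ≡⟨ +-inverseʳ T ⟩
    0ℚ                                      ∎
    where
    open ≡-Reasoning
    N N⁻¹ T : ℚ
    N   = natℚ (suc (suc n))
    N⁻¹ = (ℤ.+ 1) / suc (suc n)
    coeff : ℕ → ℚ → ℚ
    coeff j q = natℚ (suc (suc n) C j) * q
    term : ℕ → ℚ
    term j = coeff j (bernoulli j)
    T = sumℚ (zipWith coeff (upTo (suc n)) (reverse (bernRev n)))
    recurrence-sum : T ≡ sumBelow term (suc n)
    recurrence-sum = trans (cong sumℚ (trans (cong (zipWith coeff (upTo (suc n))) (reverse-bernRev n))
                                             (zipWith-map coeff (upTo (suc n)))))
                           (sumˡ-map-upTo term (suc n))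
    term-last : term (suc n) ≡ N * bernoulli (suc n)
    term-last = cong (λ k → natℚ k * bernoulli (suc n))
                     (trans (nCk≡nC[n∸k] (ℕ.n≤1+n (suc n))) (trans (cong (suc (suc n) C_) (ℕ.m+n∸n≡m 1 n)) (nC1≡n (suc (suc n)))))

  open XOverExpm1 bernoulli bernoulli⊙expm1≗X using (odd-coefficient≡0)

  bernFact-badFert : ∀ n → badFert n ≡ true → bernFact n ≡ 0ℚ
  bernFact-badFert (suc (suc n)) bad =
    trans (cong (_* 1/m!) (odd-coefficient≡0 n (∧-conicalˡ (oddB (suc (suc n))) _ bad))) (*-zeroˡ 1/m!)
    where
    1/m! : ℚ
    1/m! = ((ℤ.+ 1) / (suc (suc n) ℕ.!)) {{suc (suc n) ℕ.!≢0}}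

  mutual
    α-outside-Te1 : ∀ t → inTe1 t ≡ false → α t ≡ 0ℚ
    α-outside-Te1 (node ts) out with badFert (length ts) in bad
    ... | true  = trans (cong (_* αs ts) (bernFact-badFert (length ts) bad)) (*-zeroˡ (αs ts))
    ... | false = trans (cong (bernFact (length ts) *_) (αs-outside-Te1 ts out)) (*-zeroʳ (bernFact (length ts)))

    αs-outside-Te1 : ∀ ts → allTe1 ts ≡ false → αs ts ≡ 0ℚ
    αs-outside-Te1 (t ∷ ts) out with inTe1 t in t-out
    ... | false = trans (cong (_* αs ts) (α-outside-Te1 t t-out)) (*-zeroˡ (αs ts))
    ... | true  = trans (cong (α t *_) (αs-outside-Te1 ts out)) (*-zeroʳ (α t))

module RationalEmbedding {c ℓ : Level} (K : Field c ℓ) (cz : CharZero K) where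

  import Data.Nat as ℕ
  open import Data.Integer as ℤ using (ℤ; +_; -[1+_])
  open import Data.Sign as Sign using (Sign)
  open import Data.Rational as ℚ using (ℚ; mkℚ; 0ℚ; 1ℚ)
  import Data.Rational.Properties as ℚ
  open import Data.Rational.Unnormalised using (*≡*)
  open import Relation.Binary.PropositionalEquality as ≡ using (_≡_)
  open Field K
  open import Algebra.Properties.Ring ring using (-1*x≈-x)
  open import Algebra.Properties.Group +-group using (⁻¹-involutive)
  open import Algebra.Properties.CommutativeSemigroup *-commutativeSemigroup using (interchange; xy∙z≈xz∙y)
  open import Relation.Binary.Reasoning.Setoid setoid

  natK-+ : ∀ m n → natK K (m ℕ.+ n) ≈ natK K m + natK K n
  natK-+ zero    n = sym (+-identityˡ _)
  natK-+ (suc m) n = trans (+-congˡ (natK-+ m n)) (sym (+-assoc _ _ _))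

  natK-* : ∀ m n → natK K (m ℕ.* n) ≈ natK K m * natK K n
  natK-* zero    n = sym (zeroˡ _)
  natK-* (suc m) n = begin
    natK K (n ℕ.+ m ℕ.* n)              ≈⟨ natK-+ n (m ℕ.* n) ⟩
    natK K n + natK K (m ℕ.* n)          ≈⟨ +-congˡ (natK-* m n) ⟩
    natK K n + natK K m * natK K n       ≈⟨ +-congʳ (sym (*-identityˡ _)) ⟩
    1# * natK K n + natK K m * natK K n  ≈⟨ sym (distribʳ _ _ _) ⟩
    (1# + natK K m) * natK K n           ∎

  signK : Sign → Carrier
  signK Sign.+ = 1#
  signK Sign.- = - 1#

  signK-* : ∀ s t → signK (s Sign.* t) ≈ signK s * signK t
  signK-* Sign.+ t      = sym (*-identityˡ _)
  signK-* Sign.- Sign.+ = sym (*-identityʳ _)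
  signK-* Sign.- Sign.- = trans (sym (⁻¹-involutive 1#)) (sym (-1*x≈-x (- 1#)))

  intK-◃ : ∀ s n → intK K (s ℤ.◃ n) ≈ signK s * natK K n
  intK-◃ Sign.+ zero    = sym (zeroʳ _)
  intK-◃ Sign.- zero    = sym (zeroʳ _)
  intK-◃ Sign.+ (suc n) = sym (*-identityˡ _)
  intK-◃ Sign.- (suc n) = sym (-1*x≈-x _)

  intK-sign-abs : ∀ i → intK K i ≈ signK (ℤ.sign i) * natK K ℤ.∣ i ∣
  intK-sign-abs (+ n)    = sym (*-identityˡ _)
  intK-sign-abs -[1+ n ] = sym (-1*x≈-x _)

  intK-* : ∀ i j → intK K (i ℤ.* j) ≈ intK K i * intK K j
  intK-* i j = begin
    intK K (i ℤ.* j)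
      ≈⟨ intK-◃ (ℤ.sign i Sign.* ℤ.sign j) (ℤ.∣ i ∣ ℕ.* ℤ.∣ j ∣) ⟩
    signK (ℤ.sign i Sign.* ℤ.sign j) * natK K (ℤ.∣ i ∣ ℕ.* ℤ.∣ j ∣)
      ≈⟨ *-cong (signK-* (ℤ.sign i) (ℤ.sign j)) (natK-* ℤ.∣ i ∣ ℤ.∣ j ∣) ⟩
    (signK (ℤ.sign i) * signK (ℤ.sign j)) * (natK K ℤ.∣ i ∣ * natK K ℤ.∣ j ∣)
      ≈⟨ interchange _ _ _ _ ⟩
    (signK (ℤ.sign i) * natK K ℤ.∣ i ∣) * (signK (ℤ.sign j) * natK K ℤ.∣ j ∣)
      ≈⟨ sym (*-cong (intK-sign-abs i) (intK-sign-abs j)) ⟩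
    intK K i * intK K j ∎

  *-cancelʳ-natK-suc : ∀ d x y → x * natK K (suc d) ≈ y * natK K (suc d) → x ≈ y
  *-cancelʳ-natK-suc d x y eq = begin
    x                ≈⟨ sym (*-identityʳ x) ⟩
    x * 1#           ≈⟨ *-congˡ (sym (inverseʳ D (cz d))) ⟩
    x * (D * D⁻¹)    ≈⟨ sym (*-assoc x D D⁻¹) ⟩
    (x * D) * D⁻¹    ≈⟨ *-congʳ eq ⟩
    (y * D) * D⁻¹    ≈⟨ *-assoc y D D⁻¹ ⟩
    y * (D * D⁻¹)    ≈⟨ *-congˡ (inverseʳ D (cz d)) ⟩
    y * 1#           ≈⟨ *-identityʳ y ⟩
    y                ∎
    where
    D = natK K (suc d)
    D⁻¹ = inv D (cz d)

  embedℚ-*-denominator : ∀ q → embedℚ K cz q * natK K (ℚ.↧ₙ q) ≈ intK K (ℚ.↥ q)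
  embedℚ-*-denominator q = begin
    (intK K (ℚ.↥ q) * D⁻¹) * D  ≈⟨ *-assoc _ D⁻¹ D ⟩
    intK K (ℚ.↥ q) * (D⁻¹ * D)  ≈⟨ *-congˡ (*-comm D⁻¹ D) ⟩
    intK K (ℚ.↥ q) * (D * D⁻¹)  ≈⟨ *-congˡ (inverseʳ D (cz (ℚ.denominator-1 q))) ⟩
    intK K (ℚ.↥ q) * 1#         ≈⟨ *-identityʳ _ ⟩
    intK K (ℚ.↥ q)              ∎
    where
    D = natK K (ℚ.↧ₙ q)
    D⁻¹ = inv D (cz (ℚ.denominator-1 q))

  -- Computes embedℚ from any, possibly unreduced, fraction n / suc d equal to q.
  embedℚ-unique : ∀ x n d q → x * natK K (suc d) ≈ intK K n →
                  ℚ.↥ q ℤ.* + suc d ≡ n ℤ.* ℚ.↧ q → x ≈ embedℚ K cz q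
  embedℚ-unique x n d q x-spec cross = *-cancelʳ-natK-suc d x (embedℚ K cz q)
    (*-cancelʳ-natK-suc (ℚ.denominator-1 q) _ _ (begin
      (x * Dd) * Dq                   ≈⟨ *-congʳ x-spec ⟩
      intK K n * Dq                   ≈⟨ sym (intK-* n (ℚ.↧ q)) ⟩
      intK K (n ℤ.* ℚ.↧ q)            ≈⟨ reflexive (≡.cong (intK K) (≡.sym cross)) ⟩
      intK K (ℚ.↥ q ℤ.* + suc d)      ≈⟨ intK-* (ℚ.↥ q) (+ suc d) ⟩
      intK K (ℚ.↥ q) * Dd             ≈⟨ *-congʳ (sym (embedℚ-*-denominator q)) ⟩
      (embedℚ K cz q * Dq) * Dd       ≈⟨ xy∙z≈xz∙y _ _ _ ⟩
      (embedℚ K cz q * Dd) * Dq       ∎))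
    where
    Dd = natK K (suc d)
    Dq = natK K (ℚ.↧ₙ q)

  embedℚ-* : ∀ p q → embedℚ K cz (p ℚ.* q) ≈ embedℚ K cz p * embedℚ K cz q
  embedℚ-* p@(mkℚ n₁ d₁ _) q@(mkℚ n₂ d₂ _) with ℚ.toℚᵘ-homo-* p q
  ... | *≡* eq = sym (embedℚ-unique (embedℚ K cz p * embedℚ K cz q) (n₁ ℤ.* n₂) _ (p ℚ.* q) product-spec cross)
    where
    cross : ℚ.↥ (p ℚ.* q) ℤ.* + (suc d₁ ℕ.* suc d₂) ≡ (n₁ ℤ.* n₂) ℤ.* ℚ.↧ (p ℚ.* q)
    cross = ≡.trans (≡.cong (ℤ._* + (suc d₁ ℕ.* suc d₂)) (≡.sym (ℚ.↥ᵘ-toℚᵘ (p ℚ.* q))))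
              (≡.trans eq (≡.cong ((n₁ ℤ.* n₂) ℤ.*_) (ℚ.↧ᵘ-toℚᵘ (p ℚ.* q))))
    product-spec : (embedℚ K cz p * embedℚ K cz q) * natK K (suc d₁ ℕ.* suc d₂) ≈ intK K (n₁ ℤ.* n₂)
    product-spec = begin
      (embedℚ K cz p * embedℚ K cz q) * natK K (suc d₁ ℕ.* suc d₂)
        ≈⟨ *-congˡ (natK-* (suc d₁) (suc d₂)) ⟩
      (embedℚ K cz p * embedℚ K cz q) * (natK K (suc d₁) * natK K (suc d₂))
        ≈⟨ interchange _ _ _ _ ⟩
      (embedℚ K cz p * natK K (suc d₁)) * (embedℚ K cz q * natK K (suc d₂))
        ≈⟨ *-cong (embedℚ-*-denominator p) (embedℚ-*-denominator q) ⟩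
      intK K n₁ * intK K n₂
        ≈⟨ sym (intK-* n₁ n₂) ⟩
      intK K (n₁ ℤ.* n₂) ∎

  embedℚ-0 : embedℚ K cz 0ℚ ≈ 0#
  embedℚ-0 = zeroˡ _

  embedℚ-1 : embedℚ K cz 1ℚ ≈ 1#
  embedℚ-1 = inverseʳ (natK K 1) (cz 0)

module PreLieProduct {c ℓ m ℓm : Level} (K : Field c ℓ) (cz : CharZero K)
                     (V : Module (Field.commutativeRing K) m ℓm) (Dd : Dendriform K V) where

  open import Data.List using (map)
  open Field K using (0#)
  open Module V
  open Dendriform Dd
  open import Algebra.Properties.Group +ᴹ-group using (inverseˡ-unique)
  open import Algebra.Properties.AbelianGroup +ᴹ-abelianGroup using (⁻¹-∙-comm)
  open import Algebra.Properties.CommutativeSemigroup (CommutativeMonoid.commutativeSemigroup +ᴹ-commutativeMonoid) using (interchange)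
  open import Relation.Binary.Reasoning.Setoid ≈ᴹ-setoid
  open FiniteSums +ᴹ-commutativeMonoid public

  infixl 7 _▷_
  _▷_ : Carrierᴹ → Carrierᴹ → Carrierᴹ
  _▷_ = _▹_ K cz V Dd

  *ₗ-negʳ : ∀ r x → r *ₗ (-ᴹ x) ≈ᴹ -ᴹ (r *ₗ x)
  *ₗ-negʳ r x = inverseˡ-unique (r *ₗ (-ᴹ x)) (r *ₗ x) (begin
    r *ₗ (-ᴹ x) +ᴹ r *ₗ x  ≈⟨ ≈ᴹ-sym (*ₗ-distribˡ r (-ᴹ x) x) ⟩
    r *ₗ (-ᴹ x +ᴹ x)       ≈⟨ *ₗ-congˡ (-ᴹ‿inverseˡ x) ⟩
    r *ₗ 0ᴹ                ≈⟨ *ₗ-zeroʳ r ⟩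
    0ᴹ                     ∎)

  ▷-cong : ∀ {x x' y y'} → x ≈ᴹ x' → y ≈ᴹ y' → x ▷ y ≈ᴹ x' ▷ y'
  ▷-cong x≈x' y≈y' = +ᴹ-cong (≻-cong x≈x' y≈y') (-ᴹ‿cong (≺-cong y≈y' x≈x'))

  ▷-distribˡ : ∀ x y z → x ▷ (y +ᴹ z) ≈ᴹ x ▷ y +ᴹ x ▷ z
  ▷-distribˡ x y z = begin
    (x ≻ (y +ᴹ z)) +ᴹ (-ᴹ ((y +ᴹ z) ≺ x))                  ≈⟨ +ᴹ-cong (≻-distribˡ x y z) (-ᴹ‿cong (≺-distribʳ x y z)) ⟩
    ((x ≻ y) +ᴹ (x ≻ z)) +ᴹ (-ᴹ ((y ≺ x) +ᴹ (z ≺ x)))      ≈⟨ +ᴹ-congˡ (≈ᴹ-sym (⁻¹-∙-comm (y ≺ x) (z ≺ x))) ⟩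
    ((x ≻ y) +ᴹ (x ≻ z)) +ᴹ ((-ᴹ (y ≺ x)) +ᴹ (-ᴹ (z ≺ x))) ≈⟨ interchange _ _ _ _ ⟩
    x ▷ y +ᴹ x ▷ z                                         ∎

  ▷-distribʳ : ∀ x y z → (y +ᴹ z) ▷ x ≈ᴹ y ▷ x +ᴹ z ▷ x
  ▷-distribʳ x y z = begin
    ((y +ᴹ z) ≻ x) +ᴹ (-ᴹ (x ≺ (y +ᴹ z)))                  ≈⟨ +ᴹ-cong (≻-distribʳ x y z) (-ᴹ‿cong (≺-distribˡ x y z)) ⟩
    ((y ≻ x) +ᴹ (z ≻ x)) +ᴹ (-ᴹ ((x ≺ y) +ᴹ (x ≺ z)))      ≈⟨ +ᴹ-congˡ (≈ᴹ-sym (⁻¹-∙-comm (x ≺ y) (x ≺ z))) ⟩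
    ((y ≻ x) +ᴹ (z ≻ x)) +ᴹ ((-ᴹ (x ≺ y)) +ᴹ (-ᴹ (x ≺ z))) ≈⟨ interchange _ _ _ _ ⟩
    y ▷ x +ᴹ z ▷ x                                         ∎

  ▷-scalarˡ : ∀ r x y → (r *ₗ x) ▷ y ≈ᴹ r *ₗ (x ▷ y)
  ▷-scalarˡ r x y = begin
    ((r *ₗ x) ≻ y) +ᴹ (-ᴹ (y ≺ (r *ₗ x)))   ≈⟨ +ᴹ-cong (≻-scalarˡ r x y) (-ᴹ‿cong (≺-scalarʳ r y x)) ⟩
    (r *ₗ (x ≻ y)) +ᴹ (-ᴹ (r *ₗ (y ≺ x)))   ≈⟨ +ᴹ-congˡ (≈ᴹ-sym (*ₗ-negʳ r (y ≺ x))) ⟩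
    (r *ₗ (x ≻ y)) +ᴹ (r *ₗ (-ᴹ (y ≺ x)))   ≈⟨ ≈ᴹ-sym (*ₗ-distribˡ r _ _) ⟩
    r *ₗ (x ▷ y)                            ∎

  ▷-scalarʳ : ∀ r x y → x ▷ (r *ₗ y) ≈ᴹ r *ₗ (x ▷ y)
  ▷-scalarʳ r x y = begin
    (x ≻ (r *ₗ y)) +ᴹ (-ᴹ ((r *ₗ y) ≺ x))   ≈⟨ +ᴹ-cong (≻-scalarʳ r x y) (-ᴹ‿cong (≺-scalarˡ r y x)) ⟩
    (r *ₗ (x ≻ y)) +ᴹ (-ᴹ (r *ₗ (y ≺ x)))   ≈⟨ +ᴹ-congˡ (≈ᴹ-sym (*ₗ-negʳ r (y ≺ x))) ⟩
    (r *ₗ (x ≻ y)) +ᴹ (r *ₗ (-ᴹ (y ≺ x)))   ≈⟨ ≈ᴹ-sym (*ₗ-distribˡ r _ _) ⟩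
    r *ₗ (x ▷ y)                            ∎

  ▷-zeroˡ : ∀ x → 0ᴹ ▷ x ≈ᴹ 0ᴹ
  ▷-zeroˡ x = begin
    0ᴹ ▷ x          ≈⟨ ▷-cong (≈ᴹ-sym (*ₗ-zeroˡ 0ᴹ)) ≈ᴹ-refl ⟩
    (0# *ₗ 0ᴹ) ▷ x  ≈⟨ ▷-scalarˡ 0# 0ᴹ x ⟩
    0# *ₗ (0ᴹ ▷ x)  ≈⟨ *ₗ-zeroˡ _ ⟩
    0ᴹ              ∎

  ▷-zeroʳ : ∀ x → x ▷ 0ᴹ ≈ᴹ 0ᴹ
  ▷-zeroʳ x = begin
    x ▷ 0ᴹ          ≈⟨ ▷-cong ≈ᴹ-refl (≈ᴹ-sym (*ₗ-zeroˡ 0ᴹ)) ⟩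
    x ▷ (0# *ₗ 0ᴹ)  ≈⟨ ▷-scalarʳ 0# x 0ᴹ ⟩
    0# *ₗ (x ▷ 0ᴹ)  ≈⟨ *ₗ-zeroˡ _ ⟩
    0ᴹ              ∎

  module _ {A : Set} where

    sumˡ-map-*ₗ : ∀ r (f : A → Carrierᴹ) xs → sumˡ (map (λ x → r *ₗ f x) xs) ≈ᴹ r *ₗ sumˡ (map f xs)
    sumˡ-map-*ₗ r = sumˡ-map-homo (r *ₗ_) *ₗ-congˡ (*ₗ-zeroʳ r) (*ₗ-distribˡ r)

    sumˡ-map-▷ˡ : ∀ (f : A → Carrierᴹ) y xs → sumˡ (map (λ x → f x ▷ y) xs) ≈ᴹ sumˡ (map f xs) ▷ y
    sumˡ-map-▷ˡ f y = sumˡ-map-homo (_▷ y) (λ x≈x' → ▷-cong x≈x' ≈ᴹ-refl) (▷-zeroˡ y) (λ x x' → ▷-distribʳ y x x') f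

    sumˡ-map-▷ʳ : ∀ y (f : A → Carrierᴹ) xs → sumˡ (map (λ x → y ▷ f x) xs) ≈ᴹ y ▷ sumˡ (map f xs)
    sumˡ-map-▷ʳ y = sumˡ-map-homo (y ▷_) (▷-cong ≈ᴹ-refl) (▷-zeroʳ y) (▷-distribˡ y)

module ForestEnumeration where

  open import Data.Nat using (_∸_; _≤_; _<_; z≤n; s≤s)
  open import Data.Nat.Properties using (≤-trans; ≤-pred; m∸n≤m)
  open import Data.List using (List; []; _∷_; map; concat; concatMap; upTo; length)
  open import Data.List.Properties using (map-cong-local)
  open import Data.List.Relation.Unary.All as All using (All; []; _∷_)
  open import Data.List.Relation.Unary.All.Properties using (concat⁺; map⁺; all-upTo)
  open import Relation.Binary.PropositionalEquality

  forestsF-fuel : ∀ {f g} n → n ≤ f → n ≤ g → forestsF f n ≡ forestsF g n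
  forestsF-fuel                 zero    _         _         = refl
  forestsF-fuel {suc f} {suc g} (suc n) (s≤s n≤f) (s≤s n≤g) =
    cong concat (map-cong-local (All.map same-pieces (all-upTo (suc n))))
    where
    same-pieces : ∀ {i} → i < suc n →
                  concatMap (λ gs → map (node gs ∷_) (forestsF f (n ∸ i))) (forestsF f i) ≡
                  concatMap (λ gs → map (node gs ∷_) (forestsF g (n ∸ i))) (forestsF g i)
    same-pieces {i} i<1+n =
      cong₂ (λ gss rss → concatMap (λ gs → map (node gs ∷_) rss) gss)
            (forestsF-fuel i (≤-trans (≤-pred i<1+n) n≤f) (≤-trans (≤-pred i<1+n) n≤g))
            (forestsF-fuel (n ∸ i) (≤-trans (m∸n≤m n i) n≤f) (≤-trans (m∸n≤m n i) n≤g))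

  forestsF-length≤ : ∀ f n → All (λ ts → length ts ≤ n) (forestsF f n)
  forestsF-length≤ f       zero    = z≤n ∷ []
  forestsF-length≤ zero    (suc n) = []
  forestsF-length≤ (suc f) (suc n) = concat⁺ (map⁺ (All.universal block (upTo (suc n))))
    where
    block : ∀ i → All (λ ts → length ts ≤ suc n) (concatMap (λ gs → map (node gs ∷_) (forestsF f (n ∸ i))) (forestsF f i))
    block i = concat⁺ (map⁺ {f = λ gs → map (node gs ∷_) (forestsF f (n ∸ i))} (All.universal (λ gs →
      map⁺ {f = node gs ∷_} (All.map (λ l≤ → s≤s (≤-trans l≤ (m∸n≤m n i))) (forestsF-length≤ f (n ∸ i)))) (forestsF f i)))

module TreeExpansion {c ℓ m ℓm : Level} (K : Field c ℓ) (cz : CharZero K)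
                     (V : Module (Field.commutativeRing K) m ℓm) (Dd : Dendriform K V)
                     (a : Module.Carrierᴹ V) where

  open import Data.Nat using (_∸_; _≤_; _<_; s≤s)
  open import Data.Nat.Properties using (≤-refl; ≤-trans; ≤-pred; n≤1+n; m∸n≤m; n∸n≡0; +-∸-assoc)
  open import Data.Nat.Induction using (<-rec)
  open import Data.Rational using (ℚ) renaming (_*_ to _*ℚ_)
  open import Data.Bool using (true; false)
  open import Data.List using (List; []; _∷_; map; concatMap; upTo; length; filter)
  open import Relation.Binary.PropositionalEquality as ≡ using (_≡_)
  open import Relation.Nullary using (¬_)
  open import Relation.Nullary.Decidable using (T?)
  open import Data.Empty using (⊥-elim)
  open import Function using (_∘_)
  open Field K using (Carrier) renaming (_*_ to _*ᴷ_; sym to symᴷ; trans to transᴷ; reflexive to reflexiveᴷ)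
  open Module V
  open PreLieProduct K cz V Dd
  open RationalEmbedding K cz using (embedℚ-*; embedℚ-0; embedℚ-1)
  open ForestEnumeration
  open BernoulliNumbers using (α-outside-Te1)
  open import Relation.Binary.Reasoning.Setoid ≈ᴹ-setoid

  ι : ℚ → Carrier
  ι = embedℚ K cz

  weighted : PTree → Carrierᴹ
  weighted t = ι (α t) *ₗ F K cz V Dd t a

  treeSum : ℕ → Carrierᴹ
  treeSum d = sumˡ (map weighted (treesOfDeg d))

  grafted : ℕ → List PTree → Carrierᴹ
  grafted zero    []       = a
  grafted zero    (_ ∷ _)  = 0ᴹ
  grafted (suc k) []       = 0ᴹ
  grafted (suc k) (t ∷ ts) = weighted t ▷ grafted k ts

  forestSum : ℕ → ℕ → Carrierᴹ
  forestSum k n = sumˡ (map (grafted k) (forestsF n n))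

  sumˡ-forestsF-suc : ∀ (φ : List PTree → Carrierᴹ) f n →
    sumˡ (map φ (forestsF (suc f) (suc n))) ≈ᴹ
    sumBelow (λ i → sumˡ (map (λ gs → sumˡ (map (λ rs → φ (node gs ∷ rs)) (forestsF f (n ∸ i)))) (forestsF f i))) (suc n)
  sumˡ-forestsF-suc φ f n = begin
    sumˡ (map φ (concatMap pieces (upTo (suc n))))
      ≈⟨ sumˡ-concatMap φ pieces (upTo (suc n)) ⟩
    sumˡ (map (λ i → sumˡ (map φ (pieces i))) (upTo (suc n)))
      ≈⟨ sumˡ-map-cong (upTo (suc n)) (λ i →
           ≈ᴹ-trans (sumˡ-concatMap φ (λ gs → map (node gs ∷_) (forestsF f (n ∸ i))) (forestsF f i))
                    (sumˡ-map-cong (forestsF f i) (λ gs → ≈ᴹ-reflexive (sumˡ-map-map φ (node gs ∷_) (forestsF f (n ∸ i)))))) ⟩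
    sumˡ (map (λ i → sumˡ (map (λ gs → sumˡ (map (λ rs → φ (node gs ∷ rs)) (forestsF f (n ∸ i)))) (forestsF f i))) (upTo (suc n)))
      ≡⟨ sumˡ-map-upTo _ (suc n) ⟩
    sumBelow (λ i → sumˡ (map (λ gs → sumˡ (map (λ rs → φ (node gs ∷ rs)) (forestsF f (n ∸ i)))) (forestsF f i))) (suc n) ∎
    where
    pieces : ℕ → List (List PTree)
    pieces i = concatMap (λ gs → map (node gs ∷_) (forestsF f (n ∸ i))) (forestsF f i)

  treeSum-suc : ∀ n → treeSum (suc n) ≡ sumˡ (map (weighted ∘ node) (forestsF n n))
  treeSum-suc n = sumˡ-map-map weighted node (forestsF n n)

  forestSum-suc : ∀ k n → forestSum (suc k) (suc n) ≈ᴹ sumBelow (λ i → treeSum (suc i) ▷ forestSum k (n ∸ i)) (suc n)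
  forestSum-suc k n = ≈ᴹ-trans (sumˡ-forestsF-suc (grafted (suc k)) n n)
                               (sumBelow-cong (suc n) (λ i i<1+n → split i (≤-pred i<1+n)))
    where
    split : ∀ i → i ≤ n →
            sumˡ (map (λ gs → sumˡ (map (λ rs → weighted (node gs) ▷ grafted k rs) (forestsF n (n ∸ i)))) (forestsF n i))
              ≈ᴹ treeSum (suc i) ▷ forestSum k (n ∸ i)
    split i i≤n = begin
      sumˡ (map (λ gs → sumˡ (map (λ rs → weighted (node gs) ▷ grafted k rs) (forestsF n (n ∸ i)))) (forestsF n i))
        ≈⟨ sumˡ-map-cong (forestsF n i) (λ gs → sumˡ-map-▷ʳ (weighted (node gs)) (grafted k) (forestsF n (n ∸ i))) ⟩
      sumˡ (map (λ gs → weighted (node gs) ▷ sumˡ (map (grafted k) (forestsF n (n ∸ i)))) (forestsF n i))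
        ≡⟨ ≡.cong (λ rss → sumˡ (map (λ gs → weighted (node gs) ▷ sumˡ (map (grafted k) rss)) (forestsF n i)))
                  (forestsF-fuel (n ∸ i) (m∸n≤m n i) ≤-refl) ⟩
      sumˡ (map (λ gs → weighted (node gs) ▷ forestSum k (n ∸ i)) (forestsF n i))
        ≈⟨ sumˡ-map-▷ˡ (weighted ∘ node) (forestSum k (n ∸ i)) (forestsF n i) ⟩
      sumˡ (map (weighted ∘ node) (forestsF n i)) ▷ forestSum k (n ∸ i)
        ≡⟨ ≡.cong (λ gss → sumˡ (map (weighted ∘ node) gss) ▷ forestSum k (n ∸ i)) (forestsF-fuel i i≤n ≤-refl) ⟩
      sumˡ (map (weighted ∘ node) (forestsF i i)) ▷ forestSum k (n ∸ i)
        ≡⟨ ≡.cong (_▷ forestSum k (n ∸ i)) (≡.sym (treeSum-suc i)) ⟩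
      treeSum (suc i) ▷ forestSum k (n ∸ i) ∎

  grafted-length : ∀ ts → grafted (length ts) ts ≈ᴹ ι (αs ts) *ₗ Fs K cz V Dd ts a
  grafted-length []       = ≈ᴹ-sym (≈ᴹ-trans (*ₗ-congʳ embedℚ-1) (*ₗ-identityˡ a))
  grafted-length (t ∷ ts) = begin
    weighted t ▷ grafted (length ts) ts                       ≈⟨ ▷-cong ≈ᴹ-refl (grafted-length ts) ⟩
    (ι (α t) *ₗ Ft) ▷ (ι (αs ts) *ₗ Fts)                      ≈⟨ ▷-scalarˡ _ _ _ ⟩
    ι (α t) *ₗ (Ft ▷ (ι (αs ts) *ₗ Fts))                      ≈⟨ *ₗ-congˡ (▷-scalarʳ _ _ _) ⟩
    ι (α t) *ₗ (ι (αs ts) *ₗ (Ft ▷ Fts))                      ≈⟨ ≈ᴹ-sym (*ₗ-assoc _ _ _) ⟩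
    (ι (α t) *ᴷ ι (αs ts)) *ₗ (Ft ▷ Fts)                      ≈⟨ *ₗ-congʳ (symᴷ (embedℚ-* (α t) (αs ts))) ⟩
    ι (α t *ℚ αs ts) *ₗ (Ft ▷ Fts)                            ∎
    where
    Ft = F K cz V Dd t a
    Fts = Fs K cz V Dd ts a

  grafted-other : ∀ k ts → ¬ k ≡ length ts → grafted k ts ≈ᴹ 0ᴹ
  grafted-other zero    []       k≢0 = ⊥-elim (k≢0 ≡.refl)
  grafted-other zero    (_ ∷ _)  _   = ≈ᴹ-refl
  grafted-other (suc k) []       _   = ≈ᴹ-refl
  grafted-other (suc k) (t ∷ ts) k≢ =
    ≈ᴹ-trans (▷-cong ≈ᴹ-refl (grafted-other k ts (λ k≡ → k≢ (≡.cong suc k≡)))) (▷-zeroʳ _)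

  -- Splitting the root factor B_f/f! off α(B₊(t₁,…,t_f)) regroups trees of degree n+1 by root fertility.
  treeSum-bernoulli : ∀ n → treeSum (suc n) ≈ᴹ sumBelow (λ k → ι (bernFact k) *ₗ forestSum k n) (suc (suc n))
  treeSum-bernoulli n = begin
    treeSum (suc n)
      ≡⟨ treeSum-suc n ⟩
    sumˡ (map (weighted ∘ node) (forestsF n n))
      ≈⟨ sumˡ-map-congᴬ (forestsF-length≤ n n) by-fertility ⟩
    sumˡ (map (λ ts → sumBelow (λ k → ι (bernFact k) *ₗ grafted k ts) (suc (suc n))) (forestsF n n))
      ≈⟨ sumˡ-sumBelow-comm (λ k ts → ι (bernFact k) *ₗ grafted k ts) (suc (suc n)) (forestsF n n) ⟩
    sumBelow (λ k → sumˡ (map (λ ts → ι (bernFact k) *ₗ grafted k ts) (forestsF n n))) (suc (suc n))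
      ≈⟨ sumBelow-cong (suc (suc n)) (λ k _ → sumˡ-map-*ₗ (ι (bernFact k)) (grafted k) (forestsF n n)) ⟩
    sumBelow (λ k → ι (bernFact k) *ₗ forestSum k n) (suc (suc n)) ∎
    where
    by-fertility : ∀ ts → length ts ≤ n →
                   weighted (node ts) ≈ᴹ sumBelow (λ k → ι (bernFact k) *ₗ grafted k ts) (suc (suc n))
    by-fertility ts len≤n = begin
      weighted (node ts)
        ≈⟨ *ₗ-congʳ (embedℚ-* (bernFact (length ts)) (αs ts)) ⟩
      (ι (bernFact (length ts)) *ᴷ ι (αs ts)) *ₗ Fs K cz V Dd ts a
        ≈⟨ *ₗ-assoc _ _ _ ⟩
      ι (bernFact (length ts)) *ₗ (ι (αs ts) *ₗ Fs K cz V Dd ts a)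
        ≈⟨ *ₗ-congˡ (≈ᴹ-sym (grafted-length ts)) ⟩
      ι (bernFact (length ts)) *ₗ grafted (length ts) ts
        ≈⟨ ≈ᴹ-sym (sumBelow-single (suc (suc n)) (length ts) (s≤s (≤-trans len≤n (n≤1+n n)))
               (λ k _ k≢ → ≈ᴹ-trans (*ₗ-congˡ {x = ι (bernFact k)} (grafted-other k ts k≢)) (*ₗ-zeroʳ _))) ⟩
      sumBelow (λ k → ι (bernFact k) *ₗ grafted k ts) (suc (suc n)) ∎

  sumˡ-filter-Te1 : ∀ ts → sumˡ (map weighted (filter (λ t → T? (inTe1 t)) ts)) ≈ᴹ sumˡ (map weighted ts)
  sumˡ-filter-Te1 []       = ≈ᴹ-refl
  sumˡ-filter-Te1 (t ∷ ts) with inTe1 t in t∉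
  ... | true  = +ᴹ-congˡ (sumˡ-filter-Te1 ts)
  ... | false = ≈ᴹ-trans (sumˡ-filter-Te1 ts) (≈ᴹ-sym (≈ᴹ-trans (+ᴹ-congʳ weighted≈0) (+ᴹ-identityˡ _)))
    where
    weighted≈0 : weighted t ≈ᴹ 0ᴹ
    weighted≈0 = ≈ᴹ-trans (*ₗ-congʳ (transᴷ (reflexiveᴷ (≡.cong ι (α-outside-Te1 t t∉))) embedℚ-0)) (*ₗ-zeroˡ _)

  treeSeries≈treeSum : ∀ d → treeSeries K cz V Dd a d ≈ᴹ treeSum d
  treeSeries≈treeSum d = sumˡ-filter-Te1 (treesOfDeg d)

  module FixedPoint (Ω : Series K cz V Dd) (Ω₀≈0 : Ω 0 ≈ᴹ 0ᴹ)
                    (Ω-fixed : ∀ n → Ω n ≈ᴹ magnusRHS K cz V Dd Ω a n) where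

    L : ℕ → ℕ → Carrierᴹ
    L k = Lpow K cz V Dd Ω k (λ· K cz V Dd a)

    L-at-0 : ∀ k → L k 0 ≈ᴹ 0ᴹ
    L-at-0 zero    = ≈ᴹ-refl
    L-at-0 (suc k) = ≈ᴹ-trans (+ᴹ-identityʳ _) (≈ᴹ-trans (▷-cong Ω₀≈0 (L-at-0 k)) (▷-zeroˡ 0ᴹ))

    L-suc : ∀ k n → L (suc k) (suc n) ≈ᴹ sumBelow (λ i → Ω (suc i) ▷ L k (n ∸ i)) (suc n)
    L-suc k n = begin
      L (suc k) (suc n)                                                 ≡⟨ sumˡ-map-upTo _ (suc (suc n)) ⟩
      Ω 0 ▷ L k (suc n) +ᴹ sumBelow (λ i → Ω (suc i) ▷ L k (n ∸ i)) (suc n) ≈⟨ +ᴹ-congʳ (≈ᴹ-trans (▷-cong Ω₀≈0 ≈ᴹ-refl) (▷-zeroˡ _)) ⟩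
      0ᴹ +ᴹ sumBelow (λ i → Ω (suc i) ▷ L k (n ∸ i)) (suc n)            ≈⟨ +ᴹ-identityˡ _ ⟩
      sumBelow (λ i → Ω (suc i) ▷ L k (n ∸ i)) (suc n)                  ∎

    -- The coefficient of λⁿ⁺¹ in L_▷[Ω]ᵏ(λa) involves only Ω₁, …, Ωₙ, so agreement below N suffices.
    L≈forestSum : ∀ N → (∀ {d} → d < N → Ω (suc d) ≈ᴹ treeSum (suc d)) →
                  ∀ k n → n ≤ N → L k (suc n) ≈ᴹ forestSum k n
    L≈forestSum N agree zero    zero    _   = ≈ᴹ-sym (+ᴹ-identityʳ a)
    L≈forestSum N agree zero    (suc n) _   = ≈ᴹ-sym (≈ᴹ-trans (sumˡ-forestsF-suc (grafted 0) n n)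
      (sumBelow-ε (suc n) (λ i _ → sumˡ-map-ε (forestsF n i) (λ gs → sumˡ-map-ε (forestsF n (n ∸ i)) (λ rs → ≈ᴹ-refl)))))
    L≈forestSum N agree (suc k) zero    _   = begin
      L (suc k) 1                ≈⟨ L-suc k 0 ⟩
      Ω 1 ▷ L k 0 +ᴹ 0ᴹ          ≈⟨ +ᴹ-congʳ (≈ᴹ-trans (▷-cong ≈ᴹ-refl (L-at-0 k)) (▷-zeroʳ _)) ⟩
      0ᴹ +ᴹ 0ᴹ                   ∎
    L≈forestSum N agree (suc k) (suc n) 2+n≤N = begin
      L (suc k) (suc (suc n))
        ≈⟨ L-suc k (suc n) ⟩
      sumBelow (λ i → Ω (suc i) ▷ L k (suc n ∸ i)) (suc (suc n))
        ≈⟨ sumBelow-suc (λ i → Ω (suc i) ▷ L k (suc n ∸ i)) (suc n) ⟩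
      sumBelow (λ i → Ω (suc i) ▷ L k (suc n ∸ i)) (suc n) +ᴹ Ω (suc (suc n)) ▷ L k (suc n ∸ suc n)
        ≈⟨ +ᴹ-cong (sumBelow-cong (suc n) (λ i i<1+n → by-induction i (≤-pred i<1+n))) last≈0 ⟩
      sumBelow (λ i → treeSum (suc i) ▷ forestSum k (n ∸ i)) (suc n) +ᴹ 0ᴹ
        ≈⟨ +ᴹ-identityʳ _ ⟩
      sumBelow (λ i → treeSum (suc i) ▷ forestSum k (n ∸ i)) (suc n)
        ≈⟨ ≈ᴹ-sym (forestSum-suc k n) ⟩
      forestSum (suc k) (suc n) ∎
      where
      last≈0 : Ω (suc (suc n)) ▷ L k (suc n ∸ suc n) ≈ᴹ 0ᴹ
      last≈0 = ≈ᴹ-trans (▷-cong ≈ᴹ-refl (≈ᴹ-trans (≈ᴹ-reflexive (≡.cong (L k) (n∸n≡0 n))) (L-at-0 k))) (▷-zeroʳ _)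
      by-induction : ∀ i → i ≤ n → Ω (suc i) ▷ L k (suc n ∸ i) ≈ᴹ treeSum (suc i) ▷ forestSum k (n ∸ i)
      by-induction i i≤n =
        ▷-cong (agree (≤-trans (s≤s i≤n) 2+n≤N))
               (≈ᴹ-trans (≈ᴹ-reflexive (≡.cong (L k) (+-∸-assoc 1 i≤n)))
                         (L≈forestSum N agree k (n ∸ i) (≤-trans (m∸n≤m n i) (≤-trans (n≤1+n n) 2+n≤N))))

    Ω≈treeSum : ∀ d → Ω (suc d) ≈ᴹ treeSum (suc d)
    Ω≈treeSum = <-rec _ step
      where
      step : ∀ N → (∀ {d} → d < N → Ω (suc d) ≈ᴹ treeSum (suc d)) → Ω (suc N) ≈ᴹ treeSum (suc N)
      step N agree = begin
        Ω (suc N)                                                        ≈⟨ Ω-fixed (suc N) ⟩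
        magnusRHS K cz V Dd Ω a (suc N)                                  ≡⟨ sumˡ-map-upTo _ (suc (suc N)) ⟩
        sumBelow (λ k → ι (bernFact k) *ₗ L k (suc N)) (suc (suc N))     ≈⟨ sumBelow-cong (suc (suc N)) (λ k _ →
                                                                               *ₗ-congˡ {x = ι (bernFact k)} (L≈forestSum N agree k N ≤-refl)) ⟩
        sumBelow (λ k → ι (bernFact k) *ₗ forestSum k N) (suc (suc N))   ≈⟨ ≈ᴹ-sym (treeSum-bernoulli N) ⟩
        treeSum (suc N)                                                  ∎

mainTheorem13 : {c ℓ m ℓm : Level} (K : Field c ℓ) (cz : CharZero K)
    (V : Module (Field.commutativeRing K) m ℓm) (Dd : Dendriform K V)
    (a : Module.Carrierᴹ V) (Ω : Series K cz V Dd) →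
    Module._≈ᴹ_ V (Ω 0) (Module.0ᴹ V) →
    ((n : ℕ) → Module._≈ᴹ_ V (Ω n) (magnusRHS K cz V Dd Ω a n)) →
    (n : ℕ) → Module._≈ᴹ_ V (Ω n) (treeSeries K cz V Dd a n)
mainTheorem13 K cz V Dd a Ω Ω₀≈0 Ω-fixed zero    = Ω₀≈0
mainTheorem13 K cz V Dd a Ω Ω₀≈0 Ω-fixed (suc d) =
  ≈ᴹ-trans (Ω≈treeSum d) (≈ᴹ-sym (treeSeries≈treeSum (suc d)))
  where
  open Module V using (≈ᴹ-trans; ≈ᴹ-sym)
  open TreeExpansion K cz V Dd a
  open FixedPoint Ω Ω₀≈0 Ω-fixed
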